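{- Let $n \geq 8$ be an integer with $n \equiv 0, 1$ or $3 \pmod 4$, and let $H_n$ be the graph obtained from the wheel $W_n$ by deleting one spoke. Then $\mu_s(H_n) \leq \frac{1}{2}(n-3)$ if $n \equiv 1$ or $3 \pmod 4$, and $\mu_s(H_n) \leq \frac{n}{2}$ if $n \equiv 0 \pmod 4$.
   Context: All graphs are finite and simple. For a graph $G$ with $p=|V(G)|$ vertices and $q=|E(G)|$ edges, a super edge-magic labeling is a bijection $f: V(G)\cup E(G)\to\{1,2,\ldots,p+q\}$ with $f(V(G))=\{1,\ldots,p\}$ such that $f(x)+f(xy)+f(y)$ is the same constant for every edge $xy$; $G$ is super edge-magic if it has such a labeling. The super edge-magic deficiency $\mu_s(G)$ is the minimum nonnegative integer $t$ such that $G\cup tK_1$ (disjoint union of $G$ with $t$ isolated vertices) is super edge-magic, or $+\infty$ if no such $t$ exists. The wheel $W_n = C_n + K_1$ has vertex set $\{c, x_1,\ldots,x_n\}$ and edges $cx_i$ ($1\le i\le n$, called spokes) and $x_ix_{i+1}$ ($1\le i\le n-1$) together with $x_nx_1$. Thus $H_n$ has vertex set $\{c,x_1,\ldots,x_n\}$ and edge set $\{cx_i: 2\le i\le n\}\cup\{x_ix_{i+1}:1\le i\le n-1\}\cup\{x_nx_1\}$. -}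

module Defs where

open import Data.Nat using (ℕ; zero; suc; _+_; _∸_; _<_; _≤_)
open import Data.Nat.DivMod using (_mod_)
open import Data.Fin using (Fin; toℕ; _↑ˡ_)
open import Data.List using (List; []; _∷_; _++_; map; upTo; length; lookup)
open import Data.Product using (_×_; _,_; proj₁; proj₂; Σ; ∃; ∃-syntax)
open import Data.Sum using (_⊎_; inj₁; inj₂)
open import Function.Bundles using (_⤖_; Bijection)
open import Relation.Binary.PropositionalEquality using (_≡_)

record Graph : Set where
  constructor mkGraph
  field
    p     : ℕ
    edges : List (Fin p × Fin p)

open Graph public

q : Graph → ℕ
q G = length (edges G)

-- disjoint union G ∪ t K₁: add t isolated vertices (numbered p, …, p+t-1)
_∪K₁_ : Graph → ℕ → Graph
G ∪K₁ t = mkGraph (p G + t) (map (λ e → (proj₁ e ↑ˡ t) , (proj₂ e ↑ˡ t)) (edges G))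

-- Elements of V(G) ∪ E(G) are  Fin p ⊎ Fin q ;
-- a bijection  f : Fin p ⊎ Fin q ⤖ Fin (p + q)  encodes a bijection onto {1,…,p+q}
-- via  label x = 1 + toℕ (f x).  The vertices receive exactly the labels {1,…,p}
-- (equivalently, since f is a bijection, every vertex label is ≤ p), and
-- f(x) + f(xy) + f(y) is a constant k for every edge xy.
record SuperEdgeMagicLabeling (G : Graph) : Set where
  field
    f     : (Fin (p G) ⊎ Fin (q G)) ⤖ Fin (p G + q G)
    vertexLabels : ∀ (v : Fin (p G)) → toℕ (Bijection.to f (inj₁ v)) < p G
    k     : ℕ
    magic : ∀ (e : Fin (q G)) →
      let lab = λ x → suc (toℕ (Bijection.to f x)) in
      lab (inj₁ (proj₁ (lookup (edges G) e))) + lab (inj₂ e)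
        + lab (inj₁ (proj₂ (lookup (edges G) e))) ≡ k

SuperEdgeMagic : Graph → Set
SuperEdgeMagic G = SuperEdgeMagicLabeling G

-- μ_s(G) ≤ m  :⇔  the minimum t with G ∪ tK₁ super edge-magic exists and is ≤ m,
-- i.e. there is some t ≤ m with G ∪ tK₁ super edge-magic.
SEMDeficiency≤ : Graph → ℕ → Set
SEMDeficiency≤ G m = ∃[ t ] (t ≤ m × SuperEdgeMagic (G ∪K₁ t))

-- The wheel minus one spoke, H_n.  Vertex set Fin (suc n): c = 0, x_i = i (1 ≤ i ≤ n).
module _ (n : ℕ) where
  private
    x : ℕ → Fin (suc n)
    x i = i mod (suc n)
    c : Fin (suc n)
    c = x 0

  H : Graph
  H = mkGraph (suc n)
        ( map (λ j → c , x (2 + j)) (upTo (n ∸ 1))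
       ++ map (λ j → x (1 + j) , x (2 + j)) (upTo (n ∸ 1))
       ++ (x n , x 1) ∷ [])

module Submission where

-- A graph is super edge-magic as soon as its vertices can be labelled bijectively by 0, …, p-1
-- so that the q edge sums are consecutive integers b, …, b+q-1: giving the edge of sum b+r the
-- label p+q-1-r makes every vertex-edge-vertex sum equal (Figueroa-Centeno et al.).  So it
-- suffices to label the vertices of H_n ∪ tK₁ in this way.  Labelling the rim x₂, x₃, …
-- alternately from two runs A, B, A+1, B+1, … makes consecutive rim sums the consecutive
-- integers A+B, A+B+1, …, and the spokes and the two rim edges at x₁ fill in the rest.
--   n = 2K+1, t = K-1: c ↦ 0, x₁ ↦ 3K, the rim interleaves runs from 2K and from K, the isolated
--   vertices get 1, …, K-1.  Spoke sums: K … 3K-1, rim sums 3K … 5K-2, x_n x₁ ↦ 5K-1, x₁ x₂ ↦ 5K.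
--   n = 4h, t = 2h: c ↦ 6h, x₁ ↦ 5h-1, x₂ … x_{2h+1} interleave runs from h and from 3h-1,
--   x_{2h+2} … x_n interleave runs from 0 and from 2h, the isolated vertices get the remaining
--   labels.  Rim sums: 2h … 4h-3, then 4h-2 where the runs meet, 4h-1 … 6h-3; x_n x₁ ↦ 6h-2,
--   x₁ x₂ ↦ 6h-1, spoke sums 6h … 10h-2.

open import Defs
open import Data.Nat using (ℕ; zero; suc; _+_; _*_; _∸_; _%_; _/_; _<_; _≤_; z≤n; s≤s; s≤s⁻¹)
open import Data.Nat.Properties hiding (_≟_)
open import Data.Nat.DivMod using (_mod_; m<n⇒m%n≡m; m≡m%n+[m/n]*n; m*n/n≡m)
open import Data.Nat.Tactic.RingSolver using (solve-∀)
open import Data.Fin using (Fin; toℕ; fromℕ<; _↑ˡ_; punchOut; opposite)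
open import Data.Fin.Properties
  using (any?; _≟_; punchOut-injective; injective⇒≤; toℕ-injective; toℕ-fromℕ<; toℕ<n; toℕ-↑ˡ; toℕ-↑ʳ;
         +↔⊎; opposite-prop; opposite-involutive)
open import Data.List using (List; _++_; length; map; lookup; upTo)
open import Data.List.Properties using (length-map; length-++; length-upTo)
open import Data.List.Membership.Propositional using (_∈_)
open import Data.List.Membership.Propositional.Properties
  using (∈-map⁺; ∈-map⁻; ∈-lookup; ∈-++⁺ˡ; ∈-++⁺ʳ; ∈-++⁻; ∈-upTo⁺; ∈-upTo⁻)
open import Data.List.Relation.Unary.Any using (index; here)
open import Data.List.Relation.Unary.Any.Properties using (lookup-index)
open import Data.Product using (_×_; _,_; proj₁; proj₂; ∃; ∃₂)
open import Data.Sum using (_⊎_; inj₁; inj₂)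
open import Data.Sum.Function.Propositional using (_⊎-⤖_)
open import Data.Empty using (⊥-elim)
open import Function using (_∘_)
open import Function.Bundles using (_⤖_; Bijection; mk⤖)
open import Function.Construct.Composition using (_⤖-∘_)
open import Function.Definitions using (Injective; StrictlySurjective)
open import Function.Properties.Inverse using (↔-sym; ↔⇒⤖)
open import Relation.Binary.PropositionalEquality
open import Relation.Nullary using (yes; no)

injective⇒strictlySurjective : ∀ {m} (f : Fin m → Fin m) → Injective _≡_ _≡_ f → StrictlySurjective _≡_ f
injective⇒strictlySurjective {suc m} f f-inj y with any? (λ x → f x ≟ y)
... | yes hit = hit
... | no miss = ⊥-elim (n≮n m (injective⇒≤ g-inj))
  where
  y≢f : ∀ x → y ≢ f x
  y≢f x y≡fx = miss (x , sym y≡fx)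
  g : Fin (suc m) → Fin m
  g x = punchOut (y≢f x)
  g-inj : Injective _≡_ _≡_ g
  g-inj {a} {b} eq = f-inj (punchOut-injective (y≢f a) (y≢f b) eq)

module _ {m} (f : Fin m → Fin m) (f-onto : StrictlySurjective _≡_ f) where
  private
    section : Fin m → Fin m
    section = proj₁ ∘ f-onto

    section-inverseʳ : ∀ y → f (section y) ≡ y
    section-inverseʳ = proj₂ ∘ f-onto

    section-inverseˡ : ∀ x → section (f x) ≡ x
    section-inverseˡ x with injective⇒strictlySurjective section section-injective x
      where
      section-injective : Injective _≡_ _≡_ section
      section-injective {a} {b} eq =
        trans (sym (section-inverseʳ a)) (trans (cong f eq) (section-inverseʳ b))
    ... | a , refl = cong section (section-inverseʳ a)

  strictlySurjective⇒injective : Injective _≡_ _≡_ f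
  strictlySurjective⇒injective {x} {y} fx≡fy =
    trans (sym (section-inverseˡ x)) (trans (cong section fx≡fy) (section-inverseˡ y))

strictlySurjective⇒⤖ : ∀ {m} (f : Fin m → Fin m) → StrictlySurjective _≡_ f → Fin m ⤖ Fin m
strictlySurjective⇒⤖ f f-onto =
  mk⤖ (strictlySurjective⇒injective f f-onto , λ y → proj₁ (f-onto y) , λ { refl → proj₂ (f-onto y) })

-- Consecutive edge sums

edgeSum : ∀ {m} → (ℕ → ℕ) → Fin m × Fin m → ℕ
edgeSum label e = label (toℕ (proj₁ e)) + label (toℕ (proj₂ e))

infix 4 _≤_<_
_≤_<_ : ℕ → ℕ → ℕ → Set
a ≤ s < b = (a ≤ s) × (s < b)

record LabelPermutation (P : ℕ) : Set where
  field
    label      : ℕ → ℕ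
    label-<    : ∀ {i} → i < P → label i < P
    label-onto : ∀ {l} → l < P → ∃ λ i → i < P × label i ≡ l

castPermutation : ∀ {P P′} → P ≡ P′ → LabelPermutation P → LabelPermutation P′
castPermutation {P} {P′} P≡P′ σ = record
  { label      = label
  ; label-<    = λ i< → subst (_ <_) P≡P′ (label-< (subst (_ <_) (sym P≡P′) i<))
  ; label-onto = λ l< → onto (label-onto (subst (_ <_) (sym P≡P′) l<))
  }
  where
  open LabelPermutation σ
  onto : ∀ {l} → ∃ (λ i → i < P × label i ≡ l) → ∃ λ i → i < P′ × label i ≡ l
  onto (i , i< , eq) = i , subst (_ <_) P≡P′ i< , eq

record ConsecutiveLabeling (G : Graph) : Set where
  field
    permutation : LabelPermutation (p G)
  open LabelPermutation permutation public
  field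
    base      : ℕ
    sum-range : ∀ {e} → e ∈ edges G → base ≤ edgeSum label e < base + q G
    sum-onto  : ∀ {s} → s < q G → ∃ λ e → e ∈ edges G × edgeSum label e ≡ base + s

magic-sum : ∀ {x y P base Q r} → x + y ≡ base + r → r < Q →
  suc x + suc (P + (Q ∸ suc r)) + suc y ≡ 2 + (P + (base + Q))
magic-sum {x} {y} {P} {base} {Q} {r} x+y≡ r<Q with m≤n⇒∃[o]m+o≡n r<Q
... | d , refl = begin
  suc x + suc (P + (suc r + d ∸ suc r)) + suc y ≡⟨ cong (λ z → suc x + suc (P + z) + suc y) (m+n∸m≡n (suc r) d) ⟩
  suc x + suc (P + d) + suc y                   ≡⟨ regroupˡ x y P d ⟩
  3 + (P + d) + (x + y)                         ≡⟨ cong (3 + (P + d) +_) x+y≡ ⟩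
  3 + (P + d) + (base + r)                      ≡⟨ regroupʳ P d base r ⟩
  2 + (P + (base + (suc r + d)))                ∎
  where
  open ≡-Reasoning
  regroupˡ : ∀ x y P d → suc x + suc (P + d) + suc y ≡ 3 + (P + d) + (x + y)
  regroupˡ = solve-∀
  regroupʳ : ∀ P d base r → 3 + (P + d) + (base + r) ≡ 2 + (P + (base + (suc r + d)))
  regroupʳ = solve-∀

module _ {G : Graph} (L : ConsecutiveLabeling G) where
  open ConsecutiveLabeling L

  private
    P Q : ℕ
    P = p G
    Q = q G

    vertexMap : Fin P → Fin P
    vertexMap v = fromℕ< (label-< (toℕ<n v))

    vertexMap-onto : StrictlySurjective _≡_ vertexMap
    vertexMap-onto w with label-onto (toℕ<n w)
    ... | i , i<P , label-i≡w = fromℕ< i<P , toℕ-injective (begin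
      toℕ (vertexMap (fromℕ< i<P)) ≡⟨ toℕ-fromℕ< _ ⟩
      label (toℕ (fromℕ< i<P))     ≡⟨ cong label (toℕ-fromℕ< i<P) ⟩
      label i                      ≡⟨ label-i≡w ⟩
      toℕ w                        ∎)
      where open ≡-Reasoning

    rank : Fin Q → ℕ
    rank e = edgeSum label (lookup (edges G) e) ∸ base

    sum≡base+rank : ∀ e → edgeSum label (lookup (edges G) e) ≡ base + rank e
    sum≡base+rank e = sym (m+[n∸m]≡n (proj₁ (sum-range (∈-lookup e))))

    rank< : ∀ e → rank e < Q
    rank< e = +-cancelˡ-< base _ _ (subst (_< base + Q) (sum≡base+rank e) (proj₂ (sum-range (∈-lookup e))))

    -- The edge whose sum has rank r gets the r-th largest edge label.
    edgeMap : Fin Q → Fin Q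
    edgeMap e = opposite (fromℕ< (rank< e))

    edgeMap-onto : StrictlySurjective _≡_ edgeMap
    edgeMap-onto w with sum-onto (toℕ<n (opposite w))
    ... | _ , ab∈G , sum≡ = index ab∈G , (begin
      opposite (fromℕ< (rank< (index ab∈G))) ≡⟨ cong opposite (toℕ-injective (trans (toℕ-fromℕ< _) rank≡)) ⟩
      opposite (opposite w)                 ≡⟨ opposite-involutive w ⟩
      w                                     ∎)
      where
      open ≡-Reasoning
      rank≡ : rank (index ab∈G) ≡ toℕ (opposite w)
      rank≡ = trans (cong (λ e → edgeSum label e ∸ base) (sym (lookup-index ab∈G)))
                    (trans (cong (_∸ base) sum≡) (m+n∸m≡n base _))

    labeling : (Fin P ⊎ Fin Q) ⤖ Fin (P + Q)
    labeling = ↔⇒⤖ (↔-sym +↔⊎) ⤖-∘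
      (strictlySurjective⇒⤖ vertexMap vertexMap-onto ⊎-⤖ strictlySurjective⇒⤖ edgeMap edgeMap-onto)

    toℕ-vertex : ∀ v → toℕ (Bijection.to labeling (inj₁ v)) ≡ label (toℕ v)
    toℕ-vertex v = trans (toℕ-↑ˡ _ Q) (toℕ-fromℕ< _)

    toℕ-edge : ∀ e → toℕ (Bijection.to labeling (inj₂ e)) ≡ P + (Q ∸ suc (rank e))
    toℕ-edge e = trans (toℕ-↑ʳ P _) (cong (P +_) (trans (opposite-prop _) (cong (λ r → Q ∸ suc r) (toℕ-fromℕ< _))))

  consecutive⇒superEdgeMagic : SuperEdgeMagic G
  consecutive⇒superEdgeMagic = record
    { f            = labeling
    ; vertexLabels = λ v → subst (_< P) (sym (toℕ-vertex v)) (label-< (toℕ<n v))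
    ; k            = 2 + (P + (base + Q))
    ; magic        = λ e → begin
        _ ≡⟨ cong₂ _+_ (cong₂ (λ x y → suc x + suc y) (toℕ-vertex _) (toℕ-edge e)) (cong suc (toℕ-vertex _)) ⟩
        _ ≡⟨ magic-sum (sum≡base+rank e) (rank< e) ⟩
        _ ∎
    }
    where open ≡-Reasoning

EdgeBetween : (G : Graph) → ℕ → ℕ → Set
EdgeBetween G i j = ∃ λ e → e ∈ edges G × toℕ (proj₁ e) ≡ i × toℕ (proj₂ e) ≡ j

module _ {G : Graph} {t : ℕ} where
  private
    lift : Fin (p G) × Fin (p G) → Fin (p G + t) × Fin (p G + t)
    lift (a , b) = a ↑ˡ t , b ↑ˡ t

  ∪K₁-edge⁺ : ∀ {i j} → EdgeBetween G i j → EdgeBetween (G ∪K₁ t) i j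
  ∪K₁-edge⁺ (e , e∈G , refl , refl) = lift e , ∈-map⁺ _ e∈G , toℕ-↑ˡ _ t , toℕ-↑ˡ _ t

  ∪K₁-edge⁻ : ∀ {e} → e ∈ edges (G ∪K₁ t) → EdgeBetween G (toℕ (proj₁ e)) (toℕ (proj₂ e))
  ∪K₁-edge⁻ e∈ with ∈-map⁻ _ e∈
  ... | e′ , e′∈G , refl = e′ , e′∈G , sym (toℕ-↑ˡ _ t) , sym (toℕ-↑ˡ _ t)

  q-∪K₁ : q (G ∪K₁ t) ≡ q G
  q-∪K₁ = length-map _ (edges G)

edgeCount : ℕ → ℕ
edgeCount n = (n ∸ 1) + ((n ∸ 1) + 1)

-- Vertices are numbered c = 0 and xᵢ = i, and each edge is oriented as in the edge list of H n.
data HEdge (n : ℕ) : ℕ → ℕ → Set where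
  spoke : ∀ {j} → j < n ∸ 1 → HEdge n 0 (2 + j)
  rim   : ∀ {j} → j < n ∸ 1 → HEdge n (1 + j) (2 + j)
  close : HEdge n n 1

2+j≤n : ∀ {j n} → j < n ∸ 1 → 2 + j ≤ n
2+j≤n {n = suc n} j<n = s≤s j<n

module _ {n : ℕ} where
  private
    x : ℕ → Fin (suc n)
    x i = i mod suc n

    toℕ-x : ∀ {i} → i ≤ n → toℕ (x i) ≡ i
    toℕ-x i≤n = trans (toℕ-fromℕ< _) (m<n⇒m%n≡m (s≤s i≤n))

    spokes rims : List (Fin (suc n) × Fin (suc n))
    spokes = map (λ j → x 0 , x (2 + j)) (upTo (n ∸ 1))
    rims   = map (λ j → x (1 + j) , x (2 + j)) (upTo (n ∸ 1))

  ∈H⇒HEdge : 1 ≤ n → ∀ {e} → e ∈ edges (H n) → HEdge n (toℕ (proj₁ e)) (toℕ (proj₂ e))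
  ∈H⇒HEdge 1≤n e∈H with ∈-++⁻ spokes e∈H
  ... | inj₁ e∈spokes with ∈-map⁻ _ e∈spokes
  ...   | j , j∈ , refl rewrite toℕ-x {0} z≤n | toℕ-x (2+j≤n (∈-upTo⁻ j∈)) = spoke (∈-upTo⁻ j∈)
  ∈H⇒HEdge 1≤n e∈H | inj₂ e∈rest with ∈-++⁻ rims e∈rest
  ... | inj₁ e∈rims with ∈-map⁻ _ e∈rims
  ...   | j , j∈ , refl rewrite toℕ-x (<⇒≤ (2+j≤n (∈-upTo⁻ j∈))) | toℕ-x (2+j≤n (∈-upTo⁻ j∈)) = rim (∈-upTo⁻ j∈)
  ∈H⇒HEdge 1≤n e∈H | inj₂ e∈rest | inj₂ (here refl) rewrite toℕ-x (≤-refl {n}) | toℕ-x 1≤n = close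

  HEdge⇒∈H : 1 ≤ n → ∀ {i j} → HEdge n i j → EdgeBetween (H n) i j
  HEdge⇒∈H _ (spoke j<) =
    _ , ∈-++⁺ˡ (∈-map⁺ _ (∈-upTo⁺ j<)) , toℕ-x z≤n , toℕ-x (2+j≤n j<)
  HEdge⇒∈H _ (rim j<) =
    _ , ∈-++⁺ʳ spokes (∈-++⁺ˡ (∈-map⁺ _ (∈-upTo⁺ j<))) , toℕ-x (<⇒≤ (2+j≤n j<)) , toℕ-x (2+j≤n j<)
  HEdge⇒∈H 1≤n close =
    _ , ∈-++⁺ʳ spokes (∈-++⁺ʳ rims (here refl)) , toℕ-x ≤-refl , toℕ-x 1≤n

  q-H : q (H n) ≡ edgeCount n
  q-H = begin
    length (spokes ++ rims ++ _)           ≡⟨ length-++ spokes ⟩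
    length spokes + length (rims ++ _)     ≡⟨ cong₂ _+_ (length-mapUpTo _) (trans (length-++ rims) (cong (_+ 1) (length-mapUpTo _))) ⟩
    (n ∸ 1) + ((n ∸ 1) + 1)                ∎
    where
    open ≡-Reasoning
    length-mapUpTo : ∀ {A : Set} (f : ℕ → A) → length (map f (upTo (n ∸ 1))) ≡ n ∸ 1
    length-mapUpTo f = trans (length-map f (upTo (n ∸ 1))) (length-upTo (n ∸ 1))

record HLabeling (n t : ℕ) : Set where
  field
    permutation : LabelPermutation (suc n + t)
  open LabelPermutation permutation public
  field
    base      : ℕ
    sum-range : ∀ {i j} → HEdge n i j → base ≤ label i + label j < base + edgeCount n
    sum-onto  : ∀ {s} → s < edgeCount n → ∃₂ λ i j → HEdge n i j × label i + label j ≡ base + s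

HLabeling⇒consecutive : ∀ {n t} → 1 ≤ n → HLabeling n t → ConsecutiveLabeling (H n ∪K₁ t)
HLabeling⇒consecutive {n} {t} 1≤n L = record
  { permutation = permutation
  ; base        = base
  ; sum-range   = λ {e} e∈ → subst (λ Q → base ≤ edgeSum label e < base + Q) edgeCount≡q (sum-range (HEdge-of e∈))
  ; sum-onto    = onto
  }
  where
  open HLabeling L

  edgeCount≡q : edgeCount n ≡ q (H n ∪K₁ t)
  edgeCount≡q = sym (trans (q-∪K₁ {H n} {t}) (q-H {n}))

  HEdge-of : ∀ {e} → e ∈ edges (H n ∪K₁ t) → HEdge n (toℕ (proj₁ e)) (toℕ (proj₂ e))
  HEdge-of e∈ with ∪K₁-edge⁻ e∈
  ... | _ , e′∈H , eq₁ , eq₂ = subst₂ (HEdge n) eq₁ eq₂ (∈H⇒HEdge 1≤n e′∈H)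

  onto : ∀ {s} → s < q (H n ∪K₁ t) → ∃ λ e → e ∈ edges (H n ∪K₁ t) × edgeSum label e ≡ base + s
  onto s< with sum-onto (subst (_ <_) (sym edgeCount≡q) s<)
  ... | i , j , ij∈H , sum≡ with ∪K₁-edge⁺ (HEdge⇒∈H 1≤n ij∈H)
  ...   | e , e∈ , eq₁ , eq₂ = e , e∈ , subst₂ (λ a b → label a + label b ≡ _) (sym eq₁) (sym eq₂) sum≡

HLabeling⇒superEdgeMagic : ∀ {n t} → 1 ≤ n → HLabeling n t → SuperEdgeMagic (H n ∪K₁ t)
HLabeling⇒superEdgeMagic 1≤n = consecutive⇒superEdgeMagic ∘ HLabeling⇒consecutive 1≤n

data Cut (L : ℕ) : ℕ → Set where
  below : ∀ {m} → m < L → Cut L m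
  above : ∀ r → Cut L (L + r)

cut : ∀ L m → Cut L m
cut zero    m       = above m
cut (suc L) zero    = below (s≤s z≤n)
cut (suc L) (suc m) with cut L m
... | below m<L = below (s≤s m<L)
... | above r   = above r

data Parity : ℕ → Set where
  even : ∀ a → Parity (a + a)
  odd  : ∀ a → Parity (suc (a + a))

parity : ∀ m → Parity m
parity zero = even 0
parity (suc m) with parity m
... | even a = odd a
... | odd a  = subst Parity (+-suc (suc a) a) (even (suc a))

half-< : ∀ {a c} → a + a < c + c → a < c
half-< lt = ≰⇒> λ c≤a → <⇒≱ lt (+-mono-≤ c≤a c≤a)

odd-< : ∀ {a c} → a < c → suc (a + a) < c + c
odd-< {a} {c} a<c = subst (_≤ c + c) (+-suc (suc a) a) (+-mono-≤ a<c a<c)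

even-< : ∀ {a c} → a < c → a + a < c + c
even-< a<c = <-trans (n<1+n _) (odd-< a<c)

interleave : ℕ → ℕ → ℕ → ℕ
interleave A B zero          = A
interleave A B (suc zero)    = B
interleave A B (suc (suc m)) = suc (interleave A B m)

interleave-even : ∀ A B a → interleave A B (a + a) ≡ A + a
interleave-even A B zero    = sym (+-identityʳ A)
interleave-even A B (suc a) rewrite +-suc a a | interleave-even A B a = sym (+-suc A a)

interleave-odd : ∀ A B a → interleave A B (suc (a + a)) ≡ B + a
interleave-odd A B zero    = sym (+-identityʳ B)
interleave-odd A B (suc a) rewrite +-suc a a | interleave-odd A B a = sym (+-suc B a)

interleave-adjacent : ∀ A B m → interleave A B m + interleave A B (suc m) ≡ A + B + m
interleave-adjacent A B zero          = sym (+-identityʳ (A + B))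
interleave-adjacent A B (suc zero)    = trans (+-suc B A) (trans (cong suc (+-comm B A)) (+-comm 1 (A + B)))
interleave-adjacent A B (suc (suc m)) = begin
  suc (interleave A B m) + suc (interleave A B (suc m)) ≡⟨ cong suc (+-suc _ _) ⟩
  suc (suc (interleave A B m + interleave A B (suc m))) ≡⟨ cong (suc ∘ suc) (interleave-adjacent A B m) ⟩
  suc (suc (A + B + m))                                 ≡⟨ cong suc (+-suc (A + B) m) ⟨
  suc (A + B + suc m)                                   ≡⟨ +-suc (A + B) (suc m) ⟨
  A + B + suc (suc m)                                   ∎
  where open ≡-Reasoning

interleave-bounds : ∀ {L A B c U m} → L ≤ A → L ≤ B → A + c ≤ U → B + c ≤ U →
  m < c + c → L ≤ interleave A B m < U
interleave-bounds {L} {A} {B} {c} {U} {m} L≤A L≤B A+c≤U B+c≤U m<2c with parity m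
... | even a rewrite interleave-even A B a =
  ≤-trans L≤A (m≤m+n A a) , <-≤-trans (+-monoʳ-< A (half-< m<2c)) A+c≤U
... | odd a rewrite interleave-odd A B a =
  ≤-trans L≤B (m≤m+n B a) , <-≤-trans (+-monoʳ-< B (half-< (<-trans (n<1+n (a + a)) m<2c))) B+c≤U

glue : ℕ → (ℕ → ℕ) → (ℕ → ℕ) → ℕ → ℕ
glue zero    f g m       = g m
glue (suc L) f g zero    = f zero
glue (suc L) f g (suc m) = glue L (f ∘ suc) g m

glue-< : ∀ L f g {m} → m < L → glue L f g m ≡ f m
glue-< (suc L) f g {zero}  _         = refl
glue-< (suc L) f g {suc m} (s≤s m<L) = glue-< L (f ∘ suc) g m<L

glue-+ : ∀ L f g r → glue L f g (L + r) ≡ g r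
glue-+ zero    f g r = refl
glue-+ (suc L) f g r = glue-+ L (f ∘ suc) g r

half-double : ∀ m → (m + m) / 2 ≡ m
half-double m = trans (cong (_/ 2) (double≡ m)) (m*n/n≡m m 2)
  where
  double≡ : ∀ m → m + m ≡ m * 2
  double≡ = solve-∀

-- n odd

module Odd (k : ℕ) where
  K n : ℕ
  K = suc k
  n = suc (K + K)

  rimLabel : ℕ → ℕ
  rimLabel = interleave (K + K) K

  -- Vertex 2 + j is x_{2+j} for j < n - 1 and an isolated vertex beyond.
  label : ℕ → ℕ
  label zero          = 0
  label (suc zero)    = K + K + K
  label (suc (suc m)) = glue (K + K) rimLabel suc m

  label-rim : ∀ {j} → j < K + K → label (2 + j) ≡ rimLabel j
  label-rim = glue-< (K + K) rimLabel suc

  rimLabel-bounds : ∀ {j} → j < K + K → K ≤ rimLabel j < K + K + K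
  rimLabel-bounds = interleave-bounds (m≤m+n K K) ≤-refl ≤-refl (m≤m+n (K + K) K)

  rimLabel-onto : ∀ {a} → a < K + K → ∃ λ j → j < K + K × rimLabel j ≡ K + a
  rimLabel-onto {a} a<2K with cut K a
  ... | below a<K = suc (a + a) , odd-< a<K , interleave-odd (K + K) K a
  ... | above b   = b + b , even-< b<K , trans (interleave-even (K + K) K b) (+-assoc K K b)
    where
    b<K : b < K
    b<K = +-cancelˡ-< K b K a<2K

  label-< : ∀ {i} → i < suc (K + K + K) → label i < suc (K + K + K)
  label-< {zero}        _   = s≤s z≤n
  label-< {suc zero}    _   = ≤-refl
  label-< {suc (suc m)} i<P with cut (K + K) m
  ... | below m<2K rewrite label-rim m<2K = <-trans (proj₂ (rimLabel-bounds m<2K)) (n<1+n _)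
  ... | above r rewrite glue-+ (K + K) rimLabel suc r = ≤-<-trans (s≤s (m≤n+m r (suc (K + K)))) i<P

  label-onto : ∀ {l} → l < suc (K + K + K) → ∃ λ i → i < suc (K + K + K) × label i ≡ l
  label-onto {l} l<P with cut K l
  label-onto {zero}  _ | below _   = 0 , s≤s z≤n , refl
  label-onto {suc r} _ | below r<k = 2 + (K + K + r) , s≤s isolated< , glue-+ (K + K) rimLabel suc r
    where
    isolated< : suc (suc (K + K + r)) ≤ K + K + K
    isolated< = subst (_≤ K + K + K) (trans (+-suc (K + K) (suc r)) (cong suc (+-suc (K + K) r)))
                      (+-monoʳ-≤ (K + K) r<k)
  ... | above a with cut (K + K) a
  ...   | below a<2K with rimLabel-onto a<2K
  ...     | j , j<2K , rim≡ = 2 + j , s≤s (≤-trans (s≤s j<2K) (m<m+n (K + K) (s≤s z≤n))) , trans (label-rim j<2K) rim≡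
  label-onto _ | above _ | above zero    = 1 , s≤s (s≤s z≤n) , top≡ k
    where
    top≡ : ∀ k → suc k + suc k + suc k ≡ suc k + (suc k + suc k + 0)
    top≡ = solve-∀
  label-onto l<P | above _ | above (suc c) = ⊥-elim (<⇒≱ l<P (≤-trans (m≤m+n _ c) (≤-reflexive (beyond≡ k c))))
    where
    beyond≡ : ∀ k c → suc (suc k + suc k + suc k) + c ≡ suc k + (suc k + suc k + suc c)
    beyond≡ = solve-∀

  permutation : LabelPermutation (suc (K + K + K))
  permutation = record { label = label ; label-< = label-< ; label-onto = label-onto }

  top : ℕ
  top = K + K + K + (K + K)

  window : ∀ {s} → K ≤ s → s ≤ top → K ≤ s < K + edgeCount n
  window {s} K≤s s≤top = K≤s , subst (s <_) (sym (end≡ k)) (s≤s s≤top)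
    where
    end≡ : ∀ k → suc k + (suc k + suc k + (suc k + suc k + 1)) ≡ suc (suc k + suc k + suc k + (suc k + suc k))
    end≡ = solve-∀

  K≤3K : K ≤ K + K + K
  K≤3K = ≤-trans (m≤m+n K K) (m≤m+n (K + K) K)

  label-n : label n ≡ K + k
  label-n = begin
    label (2 + (k + K))     ≡⟨ label-rim (n<1+n (k + K)) ⟩
    rimLabel (k + suc k)    ≡⟨ cong rimLabel (+-suc k k) ⟩
    rimLabel (suc (k + k))  ≡⟨ interleave-odd (K + K) K k ⟩
    K + k                   ∎
    where open ≡-Reasoning

  sum-range : ∀ {i j} → HEdge n i j → K ≤ label i + label j < K + edgeCount n
  sum-range (spoke j<2K) with rimLabel-bounds j<2K
  ... | K≤ , <3K rewrite label-rim j<2K = window K≤ (≤-trans (<⇒≤ <3K) (m≤m+n _ _))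
  sum-range (rim {zero} _) = window (≤-trans K≤3K (m≤m+n _ _)) ≤-refl
  sum-range (rim {suc j} sj<2K) rewrite label-rim (<-trans (n<1+n j) sj<2K) | label-rim sj<2K
    | interleave-adjacent (K + K) K j =
    window (≤-trans K≤3K (m≤m+n _ j)) (+-monoʳ-≤ (K + K + K) (<⇒≤ (<-trans (n<1+n j) sj<2K)))
  sum-range close rewrite label-n =
    window (≤-trans (m≤m+n K k) (m≤m+n _ _))
           (subst (_≤ top) (+-comm (K + K + K) (K + k)) (+-monoʳ-≤ (K + K + K) (+-monoʳ-≤ K (n≤1+n k))))

  sum-onto : ∀ {s} → s < edgeCount n → ∃₂ λ i j → HEdge n i j × label i + label j ≡ K + s
  sum-onto {s} s<q with cut (K + K) s
  ... | below s<2K with rimLabel-onto s<2K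
  ...   | j , j<2K , rim≡ = 0 , 2 + j , spoke j<2K , trans (label-rim j<2K) rim≡
  sum-onto s<q | above b with cut (K + k) b
  ... | below b<K+k = 2 + b , 3 + b , rim sb<2K , (begin
    label (2 + b) + label (2 + suc b)        ≡⟨ cong₂ _+_ (label-rim (<-trans (n<1+n b) sb<2K)) (label-rim sb<2K) ⟩
    rimLabel b + rimLabel (suc b)            ≡⟨ interleave-adjacent (K + K) K b ⟩
    K + K + K + b                            ≡⟨ regroup k b ⟩
    K + (K + K + b)                          ∎)
    where
    open ≡-Reasoning
    sb<2K : suc b < K + K
    sb<2K = subst (suc (suc b) ≤_) (sym (+-suc K k)) (s≤s b<K+k)
    regroup : ∀ k b → suc k + suc k + suc k + b ≡ suc k + (suc k + suc k + b)
    regroup = solve-∀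
  sum-onto s<q | above _ | above zero = n , 1 , close , trans (cong (_+ (K + K + K)) label-n) (close≡ k)
    where
    close≡ : ∀ k → suc k + k + (suc k + suc k + suc k) ≡ suc k + (suc k + suc k + (suc k + k + 0))
    close≡ = solve-∀
  sum-onto s<q | above _ | above (suc zero) = 1 , 2 , rim (s≤s z≤n) , first≡ k
    where
    first≡ : ∀ k → suc k + suc k + suc k + (suc k + suc k) ≡ suc k + (suc k + suc k + (suc k + k + 1))
    first≡ = solve-∀
  sum-onto s<q | above _ | above (suc (suc c)) = ⊥-elim (<⇒≱ s<q (≤-trans (m≤m+n _ c) (≤-reflexive (beyond≡ k c))))
    where
    beyond≡ : ∀ k c → suc k + suc k + (suc k + suc k + 1) + c ≡ suc k + suc k + (suc k + k + suc (suc c))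
    beyond≡ = solve-∀

  vertexCount≡ : suc n + k ≡ suc (K + K + K)
  vertexCount≡ = count≡ k
    where
    count≡ : ∀ k → suc (suc (suc k + suc k)) + k ≡ suc (suc k + suc k + suc k)
    count≡ = solve-∀

  deficiency≡ : (n ∸ 3) / 2 ≡ k
  deficiency≡ = trans (cong (λ m → (m ∸ 1) / 2) (+-suc k k)) (half-double k)

  labeling : HLabeling n k
  labeling = record
    { permutation = castPermutation (sym vertexCount≡) permutation
    ; base        = K
    ; sum-range   = sum-range
    ; sum-onto    = sum-onto
    }

-- n divisible by 4

module MultipleOf4 (g : ℕ) where
  h n : ℕ
  h = suc g
  n = h + h + (h + h)

  rimLength centerLabel x₁Label : ℕ
  rimLength   = h + h + (h + g)
  centerLabel = h + h + h + h + h + h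
  x₁Label     = h + h + h + h + g

  rimLabel : ℕ → ℕ
  rimLabel = glue (h + h) (interleave h (h + h + g)) (interleave 0 (h + h))

  isolatedLabel : ℕ → ℕ
  isolatedLabel = glue h (λ r → h + h + h + g + r) (λ r → h + h + h + h + h + r)

  label : ℕ → ℕ
  label zero          = centerLabel
  label (suc zero)    = x₁Label
  label (suc (suc m)) = glue rimLength rimLabel isolatedLabel m

  label-rim : ∀ {j} → j < rimLength → label (2 + j) ≡ rimLabel j
  label-rim = glue-< rimLength rimLabel isolatedLabel

  label-isolated : ∀ r → label (2 + (rimLength + r)) ≡ isolatedLabel r
  label-isolated = glue-+ rimLength rimLabel isolatedLabel

  rimLabel-first : ∀ {j} → j < h + h → rimLabel j ≡ interleave h (h + h + g) j
  rimLabel-first = glue-< (h + h) (interleave h (h + h + g)) (interleave 0 (h + h))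

  rimLabel-second : ∀ m → rimLabel (h + h + m) ≡ interleave 0 (h + h) m
  rimLabel-second = glue-+ (h + h) (interleave h (h + h + g)) (interleave 0 (h + h))

  first<rimLength : ∀ {j} → j < h + h → j < rimLength
  first<rimLength j<2h = ≤-trans j<2h (m≤m+n (h + h) (h + g))

  second<rimLength : ∀ {m} → m < h + g → h + h + m < rimLength
  second<rimLength = +-monoʳ-< (h + h)

  rimLabel-< : ∀ {j} → j < rimLength → rimLabel j < h + h + h + g
  rimLabel-< {j} j< with cut (h + h) j
  ... | below j<2h rewrite rimLabel-first j<2h =
    proj₂ (interleave-bounds z≤n z≤n (≤-trans (m≤m+n (h + h) h) (m≤m+n _ g)) (≤-reflexive (swap g)) j<2h)
    where
    swap : ∀ g → suc g + suc g + g + suc g ≡ suc g + suc g + suc g + g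
    swap = solve-∀
  ... | above m rewrite rimLabel-second m =
    proj₂ (interleave-bounds z≤n z≤n (≤-trans (m≤m+n h (h + h)) (≤-trans (≤-reflexive (sym (+-assoc h h h))) (m≤m+n _ g)))
                             (m≤m+n _ g) m<2h)
    where
    m<2h : m < h + h
    m<2h = <-≤-trans (+-cancelˡ-< (h + h) m (h + g) j<) (+-monoʳ-≤ h (n≤1+n g))

  rimLabel-onto : ∀ {b} → b < h + h + h + g → ∃ λ j → j < rimLength × rimLabel j ≡ b
  rimLabel-onto {b} b< with cut h b
  ... | below b<h =
    h + h + (b + b) , second<rimLength (s≤s (+-mono-≤ (s≤s⁻¹ b<h) (s≤s⁻¹ b<h))) ,
    trans (rimLabel-second (b + b)) (interleave-even 0 (h + h) b)
  ... | above a with cut h a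
  ...   | below a<h =
    a + a , first<rimLength (even-< a<h) , trans (rimLabel-first (even-< a<h)) (interleave-even h (h + h + g) a)
  ...   | above c with cut g c
  ...     | below c<g =
    h + h + suc (c + c) , second<rimLength (≤-trans (odd-< c<g) (+-monoˡ-≤ g (n≤1+n g))) ,
    trans (rimLabel-second (suc (c + c))) (trans (interleave-odd 0 (h + h) c) (+-assoc h h c))
  ...     | above d =
    suc (d + d) , first<rimLength (odd-< d<h) ,
    trans (rimLabel-first (odd-< d<h)) (trans (interleave-odd h (h + h + g) d) (regroup g d))
    where
    regroup : ∀ g d → suc g + suc g + g + d ≡ suc g + (suc g + (g + d))
    regroup = solve-∀
    lhs≡ : ∀ g d → suc g + (suc g + (g + d)) ≡ suc g + suc g + g + d
    lhs≡ = solve-∀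
    rhs≡ : ∀ g → suc g + suc g + suc g + g ≡ suc g + suc g + g + suc g
    rhs≡ = solve-∀
    d<h : d < h
    d<h = +-cancelˡ-< (h + h + g) d h (subst₂ _<_ (lhs≡ g d) (rhs≡ g) b<)

  isolatedLabel-< : ∀ r → isolatedLabel r < 2 + (rimLength + r)
  isolatedLabel-< r with cut h r
  ... | below r<h rewrite glue-< h (λ r → h + h + h + g + r) (λ r → h + h + h + h + h + r) r<h =
    m+n≤o⇒m≤o _ (≤-reflexive (gap g r))
    where
    gap : ∀ g r → suc (suc g + suc g + suc g + g + r) + 1 ≡ 2 + (suc g + suc g + (suc g + g) + r)
    gap = solve-∀
  ... | above s rewrite glue-+ h (λ r → h + h + h + g + r) (λ r → h + h + h + h + h + r) s =
    m+n≤o⇒m≤o _ (≤-reflexive (gap g s))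
    where
    gap : ∀ g s → suc (suc g + suc g + suc g + suc g + suc g + s) + 0 ≡ 2 + (suc g + suc g + (suc g + g) + (suc g + s))
    gap = solve-∀

  isolated-index-< : ∀ {r} → r < h + h → 2 + (rimLength + r) < suc centerLabel
  isolated-index-< r<2h = s≤s (≤-trans (+-monoʳ-≤ (2 + rimLength) (s≤s⁻¹ r<2h)) (≤-reflexive (last≡ g)))
    where
    last≡ : ∀ g → 2 + (suc g + suc g + (suc g + g)) + (g + suc g) ≡ suc g + suc g + suc g + suc g + suc g + suc g
    last≡ = solve-∀

  rim-index-< : ∀ {j} → j < rimLength → 2 + j < suc centerLabel
  rim-index-< {j} j< = ≤-<-trans (+-monoʳ-≤ 2 (≤-trans (<⇒≤ j<) (m≤m+n rimLength 0))) (isolated-index-< {0} (s≤s z≤n))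

  label-< : ∀ {i} → i < suc centerLabel → label i < suc centerLabel
  label-< {zero}        _ = ≤-refl
  label-< {suc zero}    _ = s≤s (m+n≤o⇒m≤o x₁Label (≤-reflexive (gap g)))
    where
    gap : ∀ g → suc g + suc g + suc g + suc g + g + suc (suc g) ≡ suc g + suc g + suc g + suc g + suc g + suc g
    gap = solve-∀
  label-< {suc (suc m)} i< with cut rimLength m
  ... | below m< rewrite label-rim m< = <-trans (rimLabel-< m<) (s≤s (m+n≤o⇒m≤o _ (≤-reflexive (gap g))))
    where
    gap : ∀ g → suc g + suc g + suc g + g + suc (suc g + suc g) ≡ suc g + suc g + suc g + suc g + suc g + suc g
    gap = solve-∀
  ... | above r rewrite label-isolated r = <-trans (isolatedLabel-< r) i<

  label-onto : ∀ {l} → l < suc centerLabel → ∃ λ i → i < suc centerLabel × label i ≡ l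
  label-onto {l} l< with cut (h + h + h + g) l
  ... | below l<4h with rimLabel-onto l<4h
  ...   | j , j< , rim≡ = 2 + j , rim-index-< j< , trans (label-rim j<) rim≡
  label-onto l< | above a with cut h a
  ... | below a<h =
    2 + (rimLength + a) , isolated-index-< (≤-trans a<h (m≤m+n h h)) ,
    trans (label-isolated a) (glue-< h (λ r → h + h + h + g + r) (λ r → h + h + h + h + h + r) a<h)
  ... | above zero = 1 , s≤s (s≤s z≤n) , first≡ g
    where
    first≡ : ∀ g → suc g + suc g + suc g + suc g + g ≡ suc g + suc g + suc g + g + (suc g + 0)
    first≡ = solve-∀
  ... | above (suc c) with cut h c
  ...   | below c<h =
    2 + (rimLength + (h + c)) , isolated-index-< (+-monoʳ-< h c<h) ,
    trans (label-isolated (h + c))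
          (trans (glue-+ h (λ r → h + h + h + g + r) (λ r → h + h + h + h + h + r) c) (upper≡ g c))
    where
    upper≡ : ∀ g c → suc g + suc g + suc g + suc g + suc g + c ≡ suc g + suc g + suc g + g + (suc g + suc c)
    upper≡ = solve-∀
  ...   | above zero = 0 , s≤s z≤n , center≡ g
    where
    center≡ : ∀ g → suc g + suc g + suc g + suc g + suc g + suc g ≡ suc g + suc g + suc g + g + (suc g + suc (suc g + 0))
    center≡ = solve-∀
  ...   | above (suc d) = ⊥-elim (<⇒≱ l< (m+n≤o⇒m≤o _ (≤-reflexive (beyond≡ g d))))
    where
    beyond≡ : ∀ g d → suc (suc g + suc g + suc g + suc g + suc g + suc g) + d
                    ≡ suc g + suc g + suc g + g + (suc g + suc (suc g + suc d))
    beyond≡ = solve-∀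

  permutation : LabelPermutation (suc centerLabel)
  permutation = record { label = label ; label-< = label-< ; label-onto = label-onto }

  rimLength≡ : n ∸ 1 ≡ rimLength
  rimLength≡ = shape g
    where
    shape : ∀ g → g + suc g + (suc g + suc g) ≡ suc g + suc g + (suc g + g)
    shape = solve-∀

  label-adjacent-first : ∀ {j} → suc j < h + h → label (2 + j) + label (3 + j) ≡ h + (h + h + g) + j
  label-adjacent-first {j} sj<2h = begin
    label (2 + j) + label (3 + j)                            ≡⟨ cong₂ _+_ (label-rim (first<rimLength j<2h)) (label-rim (first<rimLength sj<2h)) ⟩
    rimLabel j + rimLabel (suc j)                            ≡⟨ cong₂ _+_ (rimLabel-first j<2h) (rimLabel-first sj<2h) ⟩
    interleave h (h + h + g) j + interleave h (h + h + g) (suc j) ≡⟨ interleave-adjacent h (h + h + g) j ⟩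
    h + (h + h + g) + j                                      ∎
    where
    open ≡-Reasoning
    j<2h : j < h + h
    j<2h = <-trans (n<1+n j) sj<2h

  label-junction : label (2 + (g + h)) + label (2 + (h + h)) ≡ h + h + g + g
  label-junction = begin
    label (2 + (g + h)) + label (2 + (h + h))                    ≡⟨ cong₂ _+_ (label-rim (first<rimLength (n<1+n (g + h))))
                                                                              (label-rim (m<m+n (h + h) (s≤s z≤n))) ⟩
    rimLabel (g + h) + rimLabel (h + h)                          ≡⟨ cong₂ _+_ (rimLabel-first (n<1+n (g + h)))
                                                                              (cong rimLabel (sym (+-identityʳ (h + h)))) ⟩
    interleave h (h + h + g) (g + h) + rimLabel (h + h + 0)      ≡⟨ cong₂ _+_ (cong (interleave h (h + h + g)) (+-suc g g)) (rimLabel-second 0) ⟩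
    interleave h (h + h + g) (suc (g + g)) + 0                   ≡⟨ +-identityʳ _ ⟩
    interleave h (h + h + g) (suc (g + g))                       ≡⟨ interleave-odd h (h + h + g) g ⟩
    h + h + g + g                                                ∎
    where open ≡-Reasoning

  label-adjacent-second : ∀ {m} → suc m < h + g → label (2 + (h + h + m)) + label (3 + (h + h + m)) ≡ h + h + m
  label-adjacent-second {m} sm<h+g = begin
    label (2 + (h + h + m)) + label (3 + (h + h + m))       ≡⟨ cong₂ _+_ (label-rim (second<rimLength (<-trans (n<1+n m) sm<h+g)))
                                                                         (label-rim (subst (_< rimLength) (+-suc (h + h) m) (second<rimLength sm<h+g))) ⟩
    rimLabel (h + h + m) + rimLabel (suc (h + h + m))       ≡⟨ cong (λ i → rimLabel (h + h + m) + rimLabel i) (+-suc (h + h) m) ⟨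
    rimLabel (h + h + m) + rimLabel (h + h + suc m)         ≡⟨ cong₂ _+_ (rimLabel-second m) (rimLabel-second (suc m)) ⟩
    interleave 0 (h + h) m + interleave 0 (h + h) (suc m)   ≡⟨ interleave-adjacent 0 (h + h) m ⟩
    h + h + m                                               ∎
    where open ≡-Reasoning

  label-n : label n ≡ g
  label-n = begin
    label n                          ≡⟨ cong label (shape g) ⟩
    label (2 + (h + h + (g + g)))    ≡⟨ label-rim (second<rimLength (n<1+n (g + g))) ⟩
    rimLabel (h + h + (g + g))       ≡⟨ rimLabel-second (g + g) ⟩
    interleave 0 (h + h) (g + g)     ≡⟨ interleave-even 0 (h + h) g ⟩
    g                                ∎
    where
    open ≡-Reasoning
    shape : ∀ g → suc g + suc g + (suc g + suc g) ≡ 2 + (suc g + suc g + (g + g))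
    shape = solve-∀

  toRim : ∀ {j} → j < n ∸ 1 → j < rimLength
  toRim {j} = subst (j <_) rimLength≡

  fromRim : ∀ {j} → j < rimLength → j < n ∸ 1
  fromRim {j} = subst (j <_) (sym rimLength≡)

  top : ℕ
  top = centerLabel + (h + h + g + g)

  window : ∀ {s} → h + h ≤ s → s ≤ top → h + h ≤ s < h + h + edgeCount n
  window {s} 2h≤s s≤top = 2h≤s , subst (s <_) (sym (end≡ g)) (s≤s s≤top)
    where
    end≡ : ∀ g → suc g + suc g + ((g + suc g + (suc g + suc g)) + ((g + suc g + (suc g + suc g)) + 1))
               ≡ suc (suc g + suc g + suc g + suc g + suc g + suc g + (suc g + suc g + g + g))
    end≡ = solve-∀

  rimLength≤top : rimLength ≤ top
  rimLength≤top = m+n≤o⇒m≤o rimLength (≤-reflexive (gap g))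
    where
    gap : ∀ g → suc g + suc g + (suc g + g) + (suc g + suc g + suc g + suc g + suc g + g)
              ≡ suc g + suc g + suc g + suc g + suc g + suc g + (suc g + suc g + g + g)
    gap = solve-∀

  rim-sum-range : ∀ {j} → suc j < rimLength → h + h ≤ label (2 + j) + label (3 + j) < h + h + edgeCount n
  rim-sum-range {j} sj< with cut (g + h) j
  ... | below j< rewrite label-adjacent-first (s≤s j<) =
    window (≤-trans (+-monoʳ-≤ h (≤-trans (m≤m+n h h) (m≤m+n _ g))) (m≤m+n _ j))
           (≤-trans (+-monoʳ-≤ (h + (h + h + g)) (<⇒≤ j<)) (m+n≤o⇒m≤o _ (≤-reflexive (below≡ g))))
    where
    below≡ : ∀ g → suc g + (suc g + suc g + g) + (g + suc g) + (suc g + suc g + suc g + suc g)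
               ≡ suc g + suc g + suc g + suc g + suc g + suc g + (suc g + suc g + g + g)
    below≡ = solve-∀
  ... | above zero rewrite +-identityʳ (g + h) | label-junction =
    window (≤-trans (m≤m+n (h + h) g) (m≤m+n _ g)) (m≤n+m _ centerLabel)
  ... | above (suc m) rewrite +-suc (g + h) m =
    second-pair (+-cancelˡ-< (h + h) (suc m) (h + g) (subst (_< rimLength) (sym (+-suc (h + h) m)) sj<))
    where
    second-pair : suc m < h + g → h + h ≤ label (2 + (h + h + m)) + label (3 + (h + h + m)) < h + h + edgeCount n
    second-pair sm< rewrite label-adjacent-second sm< =
      window (m≤m+n (h + h) m) (≤-trans (<⇒≤ (second<rimLength (<-trans (n<1+n m) sm<))) rimLength≤top)

  sum-range : ∀ {i j} → HEdge n i j → h + h ≤ label i + label j < h + h + edgeCount n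
  sum-range (spoke {j} j<) rewrite label-rim (toRim j<) =
    window (≤-trans (m+n≤o⇒m≤o (h + h) (≤-reflexive (gap g))) (m≤m+n centerLabel _))
           (+-monoʳ-≤ centerLabel (s≤s⁻¹ (subst (rimLabel j <_) (shape g) (rimLabel-< (toRim j<)))))
    where
    gap : ∀ g → suc g + suc g + (suc g + suc g + suc g + suc g) ≡ suc g + suc g + suc g + suc g + suc g + suc g
    gap = solve-∀
    shape : ∀ g → suc g + suc g + suc g + g ≡ suc (suc g + suc g + g + g)
    shape = solve-∀
  sum-range (rim {zero} _) =
    window (m+n≤o⇒m≤o (h + h) (≤-reflexive (above≡ g))) (m+n≤o⇒m≤o _ (≤-reflexive (below≡ g)))
    where
    above≡ : ∀ g → suc g + suc g + (suc g + suc g + suc g + g) ≡ suc g + suc g + suc g + suc g + g + suc g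
    above≡ = solve-∀
    below≡ : ∀ g → suc g + suc g + suc g + suc g + g + suc g + (suc g + suc g + suc g + g)
               ≡ suc g + suc g + suc g + suc g + suc g + suc g + (suc g + suc g + g + g)
    below≡ = solve-∀
  sum-range (rim {suc j} sj<) = rim-sum-range (toRim sj<)
  sum-range close rewrite label-n =
    window (m+n≤o⇒m≤o (h + h) (≤-reflexive (above≡ g))) (m+n≤o⇒m≤o _ (≤-reflexive (below≡ g)))
    where
    above≡ : ∀ g → suc g + suc g + (suc g + suc g + g + g) ≡ g + (suc g + suc g + suc g + suc g + g)
    above≡ = solve-∀
    below≡ : ∀ g → g + (suc g + suc g + suc g + suc g + g) + (suc g + suc g + suc g + suc g)
               ≡ suc g + suc g + suc g + suc g + suc g + suc g + (suc g + suc g + g + g)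
    below≡ = solve-∀

  sum-onto : ∀ {s} → s < edgeCount n → ∃₂ λ i j → HEdge n i j × label i + label j ≡ h + h + s
  sum-onto {s} s<q with cut (g + g) s
  ... | below s<2g =
    2 + (h + h + s) , 3 + (h + h + s) ,
    rim (fromRim (subst (_< rimLength) (+-suc (h + h) s) (second<rimLength (s≤s s<2g)))) ,
    label-adjacent-second (s≤s s<2g)
  ... | above zero = 2 + (g + h) , 2 + (h + h) , rim (fromRim (m<m+n (h + h) (s≤s z≤n))) , trans label-junction (junction≡ g)
    where
    junction≡ : ∀ g → suc g + suc g + g + g ≡ suc g + suc g + (g + g + 0)
    junction≡ = solve-∀
  ... | above (suc a) with cut (g + h) a
  ...   | below a< = 2 + a , 3 + a , rim (fromRim (first<rimLength (s≤s a<))) , trans (label-adjacent-first (s≤s a<)) (first≡ g a)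
    where
    first≡ : ∀ g a → suc g + (suc g + suc g + g) + a ≡ suc g + suc g + (g + g + suc a)
    first≡ = solve-∀
  ...   | above zero = n , 1 , close , trans (cong (_+ x₁Label) label-n) (close≡ g)
    where
    close≡ : ∀ g → g + (suc g + suc g + suc g + suc g + g) ≡ suc g + suc g + (g + g + suc (g + suc g + 0))
    close≡ = solve-∀
  ...   | above (suc zero) = 1 , 2 , rim (fromRim (s≤s z≤n)) , start≡ g
    where
    start≡ : ∀ g → suc g + suc g + suc g + suc g + g + suc g ≡ suc g + suc g + (g + g + suc (g + suc g + 1))
    start≡ = solve-∀
  ...   | above (suc (suc c)) with rimLabel-onto c<4h
    where
    s≡ : ∀ g c → g + g + suc (g + suc g + suc (suc c)) ≡ suc g + suc g + suc g + suc g + c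
    s≡ = solve-∀
    q≡ : ∀ g → (g + suc g + (suc g + suc g)) + ((g + suc g + (suc g + suc g)) + 1)
             ≡ suc g + suc g + suc g + suc g + (suc g + suc g + suc g + g)
    q≡ = solve-∀
    c<4h : c < h + h + h + g
    c<4h = +-cancelˡ-< (h + h + h + h) c _ (subst₂ _<_ (s≡ g c) (q≡ g) s<q)
  ...     | j , j< , rim≡ = 0 , 2 + j , spoke (fromRim j<) , trans (cong (centerLabel +_) (trans (label-rim j<) rim≡)) (spoke≡ g c)
    where
    spoke≡ : ∀ g c → suc g + suc g + suc g + suc g + suc g + suc g + c ≡ suc g + suc g + (g + g + suc (g + suc g + suc (suc c)))
    spoke≡ = solve-∀

  vertexCount≡ : suc n + (h + h) ≡ suc centerLabel
  vertexCount≡ = count≡ g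
    where
    count≡ : ∀ g → suc (suc g + suc g + (suc g + suc g)) + (suc g + suc g) ≡ suc (suc g + suc g + suc g + suc g + suc g + suc g)
    count≡ = solve-∀

  deficiency≡ : n / 2 ≡ h + h
  deficiency≡ = half-double (h + h)

  labeling : HLabeling n (h + h)
  labeling = record
    { permutation = castPermutation (sym vertexCount≡) permutation
    ; base        = h + h
    ; sum-range   = sum-range
    ; sum-onto    = sum-onto
    }

odd-form : ∀ {n} → 3 ≤ n → n % 4 ≡ 1 ⊎ n % 4 ≡ 3 → ∃ λ k → n ≡ Odd.n k
odd-form {n} 3≤n n%4 with n / 4 | m≡m%n+[m/n]*n n 4
odd-form 3≤n (inj₁ r≡1) | zero  | n≡ = ⊥-elim (<⇒≱ (s≤s (s≤s z≤n)) (subst (3 ≤_) (trans n≡ (cong (_+ 0) r≡1)) 3≤n))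
odd-form 3≤n (inj₁ r≡1) | suc q | n≡ = suc (q + q) , trans n≡ (trans (cong (_+ suc q * 4) r≡1) (form q))
  where
  form : ∀ q → 1 + suc q * 4 ≡ suc (suc (suc (q + q)) + suc (suc (q + q)))
  form = solve-∀
odd-form 3≤n (inj₂ r≡3) | q     | n≡ = q + q , trans n≡ (trans (cong (_+ q * 4) r≡3) (form q))
  where
  form : ∀ q → 3 + q * 4 ≡ suc (suc (q + q) + suc (q + q))
  form = solve-∀

multipleOf4-form : ∀ {n} → 1 ≤ n → n % 4 ≡ 0 → ∃ λ g → n ≡ MultipleOf4.n g
multipleOf4-form {n} 1≤n r≡0 with n / 4 | m≡m%n+[m/n]*n n 4
... | zero  | n≡ = ⊥-elim (<⇒≱ 1≤n (≤-reflexive (trans n≡ (cong (_+ 0) r≡0))))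
... | suc g | n≡ = g , trans n≡ (trans (cong (_+ suc g * 4) r≡0) (form g))
  where
  form : ∀ g → 0 + suc g * 4 ≡ suc g + suc g + (suc g + suc g)
  form = solve-∀

theorem2 : ∀ (n : ℕ) → 8 ≤ n →
    ((n % 4 ≡ 1 ⊎ n % 4 ≡ 3) → SEMDeficiency≤ (H n) ((n ∸ 3) / 2))
    × (n % 4 ≡ 0 → SEMDeficiency≤ (H n) (n / 2))
theorem2 n 8≤n = odd-case , multipleOf4-case
  where
  odd-case : (n % 4 ≡ 1 ⊎ n % 4 ≡ 3) → SEMDeficiency≤ (H n) ((n ∸ 3) / 2)
  odd-case n%4 with odd-form (≤-trans (s≤s (s≤s (s≤s z≤n))) 8≤n) n%4
  ... | k , refl = _ , ≤-reflexive (sym (Odd.deficiency≡ k)) , HLabeling⇒superEdgeMagic (s≤s z≤n) (Odd.labeling k)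

  multipleOf4-case : n % 4 ≡ 0 → SEMDeficiency≤ (H n) (n / 2)
  multipleOf4-case n%4 with multipleOf4-form (≤-trans (s≤s z≤n) 8≤n) n%4
  ... | g , refl = _ , ≤-reflexive (sym (MultipleOf4.deficiency≡ g)) ,
                   HLabeling⇒superEdgeMagic (s≤s z≤n) (MultipleOf4.labeling g)
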